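{- Let $w$ be a right-infinite word over a finite alphabet, let $n\ge 1$, and let $c$ be the number of distinct subwords of $w$ of length $n$ that have valence $1$ in $w$. If $w$ has a subword $u$ of length $n+c$ all of whose subwords of length $n$ have valence $1$ in $w$, then $w$ is ultimately periodic.
   Context: A finite word $u$ is a subword (factor) of the right-infinite word $w=w_1w_2\cdots$ if $u=w_iw_{i+1}\cdots w_j$ for some $i\le j$. The valence of a subword $u$ in $w$ is the number of distinct letters $a$ such that $ua$ is a subword of $w$. $w$ is ultimately periodic if $w=xv^\infty=xvvv\cdots$ for finite words $x,v$ with $v$ nonempty. -}

module Defs where

open import Data.Nat using (ℕ; zero; suc; _+_; _∸_; _<_; _≥_; NonZero)
open import Data.Nat.DivMod using (_%_)
open import Data.Fin using (Fin)
open import Data.List using (List; []; _∷_; length; _++_; [_])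
open import Data.List.Membership.Propositional using (_∈_)
open import Data.List.Relation.Unary.Unique.Propositional using (Unique)
open import Data.List.Relation.Unary.All using (All)
open import Data.Product using (Σ; ∃; ∃-syntax; _×_; _,_)
open import Relation.Binary.PropositionalEquality using (_≡_)
open import Relation.Nullary using (¬_)

Word : Set → Set
Word A = ℕ → A

factorAt : {A : Set} → Word A → ℕ → ℕ → List A
factorAt w i zero    = []
factorAt w i (suc m) = w i ∷ factorAt w (suc i) m

IsSubword : {A : Set} → List A → Word A → Set
IsSubword u w = ∃[ i ] factorAt w i (length u) ≡ u

HasValence1 : {A : Set} → Word A → List A → Set
HasValence1 w u =
  ∃[ a ] (IsSubword (u ++ [ a ]) w × (∀ b → IsSubword (u ++ [ b ]) w → b ≡ a))

-- L lists, without repetition, exactly the subwords of w of length n having valence 1.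
-- (So length L is the number c of such subwords.)
Valence1Factors : {A : Set} → Word A → ℕ → List (List A) → Set
Valence1Factors w n L =
  Unique L ×
  (∀ u → (u ∈ L → IsSubword u w × length u ≡ n × HasValence1 w u)
       × (IsSubword u w × length u ≡ n × HasValence1 w u → u ∈ L))

cycleAt : {A : Set} → (v : List A) → .{{NonZero (length v)}} → ℕ → A
cycleAt v j = Data.List.lookup v (Data.Fin.fromℕ< (Data.Nat.DivMod.m%n<n j (length v)))
  where import Data.Nat.DivMod

-- the word x v^∞ read at position i.
prefixCycleAt : {A : Set} → (x v : List A) → .{{NonZero (length v)}} → ℕ → A
prefixCycleAt x v i with Data.Nat._<?_ i (length x)
... | Relation.Nullary.yes p = Data.List.lookup x (Data.Fin.fromℕ< p)
... | Relation.Nullary.no _  = cycleAt v (i ∸ length x)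

UltimatelyPeriodic : {A : Set} → Word A → Set
UltimatelyPeriodic {A} w =
  Σ (List A) λ x → Σ (List A) λ v → Σ (NonZero (length v)) λ nz →
    ∀ i → w i ≡ prefixCycleAt x v {{nz}} i

-- The factor of length n at position t + 1 is obtained from the one at t by dropping
-- the first letter and appending the next letter of w; if the factor at t has valence 1,
-- that letter is the unique right extension, so the factor at t + 1 is a function of the
-- factor at t. The c + 1 factors of length n starting inside u all have valence 1 and
-- take at most c values, so two of them coincide, at positions p and p + d. From then
-- on the factor sequence, and with it w, repeats with period d.
module Submission where

open import Defs
open import Data.Nat using (ℕ; _+_; _≥_)
open import Data.Fin using (Fin)
open import Data.List using (List; length)
open import Data.List.Relation.Binary.Infix.Heterogeneous using (Infix)
open import Relation.Binary.PropositionalEquality using (_≡_)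

open import Data.Nat using (zero; suc; _∸_; _<_; _≤_; s≤s; NonZero; >-nonZero⁻¹; _<?_)
open import Data.Nat.Properties
open import Data.Nat.DivMod using (_%_; _/_; %-congˡ; m≡m%n+[m/n]*n; [m+kn]%n≡m%n; m%n<n; n%n≡0; m<n⇒m%n≡m)
open import Data.Fin using (toℕ; fromℕ<)
open import Data.Fin.Properties using (toℕ-fromℕ<; toℕ≤pred[n]; pigeonhole)
open import Data.List using (_∷_; _++_; [_]; drop; lookup)
open import Data.List.Properties using (∷-injectiveˡ)
open import Data.List.Membership.Propositional using (_∈_)
open import Data.List.Relation.Unary.Any using (index)
open import Data.List.Relation.Unary.Any.Properties using (lookup-index)
open import Data.List.Relation.Binary.Prefix.Heterogeneous using (Prefix; []; _∷_)
open import Data.List.Relation.Binary.Infix.Heterogeneous using (here; there)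
open import Data.Product using (∃₂; _×_; _,_; proj₁; proj₂)
open import Data.Sum using (inj₁; inj₂)
open import Relation.Binary.PropositionalEquality using (refl; sym; trans; cong; cong₂; subst; module ≡-Reasoning)
open import Relation.Nullary using (yes; no)

%-congʳ : ∀ m {n o} .{{_ : NonZero n}} .{{_ : NonZero o}} → n ≡ o → m % n ≡ m % o
%-congʳ m refl = refl

suc[m%n]%n≡suc[m]%n : ∀ m n .{{_ : NonZero n}} → suc (m % n) % n ≡ suc m % n
suc[m%n]%n≡suc[m]%n m n =
  trans (sym ([m+kn]%n≡m%n (suc (m % n)) (m / n) n))
        (%-congˡ (cong suc (sym (m≡m%n+[m/n]*n m n))))

pigeonhole-∈ : {X : Set} (L : List X) (f : ℕ → X) → (∀ s → s ≤ length L → f s ∈ L) →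
               ∃₂ λ a o → a + suc o ≤ length L × f a ≡ f (a + suc o)
pigeonhole-∈ L f f∈L
  with i , j , i<j , same-index ← pigeonhole (n<1+n (length L)) (λ s → index (f∈L (toℕ s) (toℕ≤pred[n] s)))
  with o , i+o≡j ← m≤n⇒∃[o]m+o≡n i<j
  = toℕ i , o , subst (_≤ length L) (sym i+suc[o]≡j) (toℕ≤pred[n] j) , f[i]≡f[i+suc[o]]
  where
  open ≡-Reasoning
  i+suc[o]≡j : toℕ i + suc o ≡ toℕ j
  i+suc[o]≡j = trans (+-suc (toℕ i) o) i+o≡j
  f[i]≡f[i+suc[o]] : f (toℕ i) ≡ f (toℕ i + suc o)
  f[i]≡f[i+suc[o]] = begin
    f (toℕ i)                                  ≡⟨ lookup-index (f∈L (toℕ i) (toℕ≤pred[n] i)) ⟩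
    lookup L (index (f∈L _ (toℕ≤pred[n] i)))   ≡⟨ cong (lookup L) same-index ⟩
    lookup L (index (f∈L _ (toℕ≤pred[n] j)))   ≡⟨ sym (lookup-index (f∈L (toℕ j) (toℕ≤pred[n] j))) ⟩
    f (toℕ j)                                  ≡⟨ cong f (sym i+suc[o]≡j) ⟩
    f (toℕ i + suc o)                          ∎

module _ {A : Set} (w : Word A) where

  length-factorAt : ∀ i m → length (factorAt w i m) ≡ m
  length-factorAt i zero    = refl
  length-factorAt i (suc m) = cong suc (length-factorAt (suc i) m)

  factorAt-isSubword : ∀ i m → IsSubword (factorAt w i m) w
  factorAt-isSubword i m = i , cong (factorAt w i) (length-factorAt i m)

  factorAt-suc : ∀ i m → factorAt w i (suc m) ≡ factorAt w i m ++ [ w (i + m) ]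
  factorAt-suc i zero    = cong (λ k → [ w k ]) (sym (+-identityʳ i))
  factorAt-suc i (suc m) =
    cong (w i ∷_) (trans (factorAt-suc (suc i) m) (cong (λ k → factorAt w (suc i) m ++ [ w k ]) (sym (+-suc i m))))

  factorAt-prefix : ∀ i n m → n ≤ m → Prefix _≡_ (factorAt w i n) (factorAt w i m)
  factorAt-prefix i zero    m       _         = []
  factorAt-prefix i (suc n) (suc m) (s≤s n≤m) = refl ∷ factorAt-prefix (suc i) n m n≤m

  factorAt-infix : ∀ i s n m → s + n ≤ m → Infix _≡_ (factorAt w (i + s) n) (factorAt w i m)
  factorAt-infix i zero    n m       s+n≤m rewrite +-identityʳ i = here (factorAt-prefix i n m s+n≤m)
  factorAt-infix i (suc s) n (suc m) (s≤s s+n≤m) rewrite +-suc i s = there (factorAt-infix (suc i) s n m s+n≤m)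

  lookup-factorAt : ∀ i m (k : Fin (length (factorAt w i m))) → lookup (factorAt w i m) k ≡ w (i + toℕ k)
  lookup-factorAt i (suc m) Fin.zero    = cong w (sym (+-identityʳ i))
  lookup-factorAt i (suc m) (Fin.suc k) = trans (lookup-factorAt (suc i) m k) (cong w (sym (+-suc i (toℕ k))))

  factorAt-head : ∀ i j m → factorAt w i (suc m) ≡ factorAt w j (suc m) → w i ≡ w j
  factorAt-head i j m = ∷-injectiveˡ

  valence1-next-factor : ∀ i j n → HasValence1 w (factorAt w j n) →
                         factorAt w i n ≡ factorAt w j n → factorAt w (suc i) n ≡ factorAt w (suc j) n
  valence1-next-factor i j n (a , _ , unique) same = begin
    factorAt w (suc i) n                     ≡⟨ cong (drop 1) (factorAt-suc i n) ⟩
    drop 1 (factorAt w i n ++ [ w (i + n) ]) ≡⟨ cong₂ (λ v b → drop 1 (v ++ [ b ])) same (trans next-i (sym next-j)) ⟩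
    drop 1 (factorAt w j n ++ [ w (j + n) ]) ≡⟨ cong (drop 1) (sym (factorAt-suc j n)) ⟩
    factorAt w (suc j) n                     ∎
    where
    open ≡-Reasoning
    extension-isSubword : ∀ k → IsSubword (factorAt w k n ++ [ w (k + n) ]) w
    extension-isSubword k = subst (λ v → IsSubword v w) (factorAt-suc k n) (factorAt-isSubword k (suc n))
    next-i : w (i + n) ≡ a
    next-i = unique _ (subst (λ v → IsSubword (v ++ [ w (i + n) ]) w) same (extension-isSubword i))
    next-j : w (j + n) ≡ a
    next-j = unique _ (extension-isSubword j)

  factorAt-periodic : ∀ p d n .{{_ : NonZero d}} →
                      factorAt w p n ≡ factorAt w (p + d) n →
                      (∀ r → r < d → HasValence1 w (factorAt w (p + r) n)) →
                      ∀ t → factorAt w (p + t) n ≡ factorAt w (p + t % d) n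
  factorAt-periodic p d n repeat valence1 = periodic
    where
    open ≡-Reasoning
    F : ℕ → List A
    F t = factorAt w (p + t) n
    wrap : ∀ k → k ≤ d → F k ≡ F (k % d)
    wrap k k≤d with m≤n⇒m<n∨m≡n k≤d
    ... | inj₁ k<d  = cong F (sym (m<n⇒m%n≡m k<d))
    ... | inj₂ refl = begin
      F k            ≡⟨ sym repeat ⟩
      factorAt w p n ≡⟨ cong (λ i → factorAt w i n) (sym (+-identityʳ p)) ⟩
      F 0            ≡⟨ cong F (sym (n%n≡0 k)) ⟩
      F (k % k)      ∎
    periodic : ∀ t → F t ≡ F (t % d)
    periodic zero    = cong F (sym (m<n⇒m%n≡m (>-nonZero⁻¹ d)))
    periodic (suc t) = begin
      F (suc t)                      ≡⟨ cong (λ i → factorAt w i n) (+-suc p t) ⟩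
      factorAt w (suc (p + t)) n     ≡⟨ valence1-next-factor (p + t) (p + t % d) n (valence1 _ (m%n<n t d)) (periodic t) ⟩
      factorAt w (suc (p + t % d)) n ≡⟨ cong (λ i → factorAt w i n) (sym (+-suc p (t % d))) ⟩
      F (suc (t % d))                ≡⟨ wrap (suc (t % d)) (m%n<n t d) ⟩
      F (suc (t % d) % d)            ≡⟨ cong F (suc[m%n]%n≡suc[m]%n t d) ⟩
      F (suc t % d)                  ∎

  cycleAt-factorAt : ∀ p d j .{{_ : NonZero d}} .{{nz : NonZero (length (factorAt w p d))}} →
                     cycleAt (factorAt w p d) j ≡ w (p + j % d)
  cycleAt-factorAt p d j =
    trans (lookup-factorAt p d _)
          (cong (λ k → w (p + k)) (trans (toℕ-fromℕ< _) (%-congʳ j (length-factorAt p d))))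

  ultimatelyPeriodic : ∀ p d {{_ : NonZero d}} → (∀ t → w (p + t) ≡ w (p + t % d)) → UltimatelyPeriodic w
  ultimatelyPeriodic p d {{d≢0}} periodic = x , v , nz , agree
    where
    open ≡-Reasoning
    x v : List A
    x = factorAt w 0 p
    v = factorAt w p d
    nz : NonZero (length v)
    nz = subst NonZero (sym (length-factorAt p d)) d≢0
    agree : ∀ i → w i ≡ prefixCycleAt x v {{nz}} i
    agree i with i <? length x
    ... | yes i<p = sym (trans (lookup-factorAt 0 p (fromℕ< i<p)) (cong w (toℕ-fromℕ< i<p)))
    ... | no  i≮p = begin
      w i                             ≡⟨ cong w (sym (m+[n∸m]≡n p≤i)) ⟩
      w (p + (i ∸ p))                 ≡⟨ periodic (i ∸ p) ⟩
      w (p + (i ∸ p) % d)             ≡⟨ sym (cycleAt-factorAt p d (i ∸ p) {{nz = nz}}) ⟩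
      cycleAt v {{nz}} (i ∸ p)        ≡⟨ cong (λ k → cycleAt v {{nz}} (i ∸ k)) (sym (length-factorAt 0 p)) ⟩
      cycleAt v {{nz}} (i ∸ length x) ∎
      where
      p≤i : p ≤ i
      p≤i = subst (_≤ i) (length-factorAt 0 p) (≮⇒≥ i≮p)

  ultimatelyPeriodic-of-valence1-run :
    ∀ n q (L : List (List A)) → n ≥ 1 →
    (∀ s → s ≤ length L → factorAt w (q + s) n ∈ L × HasValence1 w (factorAt w (q + s) n)) →
    UltimatelyPeriodic w
  ultimatelyPeriodic-of-valence1-run (suc m) q L _ run
    with a , o , a+d≤|L| , repeat ← pigeonhole-∈ L (λ s → factorAt w (q + s) (suc m)) (λ s s≤ → proj₁ (run s s≤))
    = ultimatelyPeriodic (q + a) (suc o) λ t →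
        factorAt-head _ _ m (factorAt-periodic (q + a) (suc o) (suc m) repeat′ valence1 t)
    where
    regroup : ∀ r → q + (a + r) ≡ q + a + r
    regroup r = sym (+-assoc q a r)
    repeat′ : factorAt w (q + a) (suc m) ≡ factorAt w (q + a + suc o) (suc m)
    repeat′ = trans repeat (cong (λ i → factorAt w i (suc m)) (regroup (suc o)))
    valence1 : ∀ r → r < suc o → HasValence1 w (factorAt w (q + a + r) (suc m))
    valence1 r r<d = subst (λ i → HasValence1 w (factorAt w i (suc m))) (regroup r)
      (proj₂ (run (a + r) (≤-trans (+-monoʳ-≤ a (<⇒≤ r<d)) a+d≤|L|)))

lemma5p6 : (k : ℕ) (w : Word (Fin k)) (n : ℕ) → n ≥ 1 →
    (c : ℕ) (L : List (List (Fin k))) → Valence1Factors w n L → length L ≡ c →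
    (u : List (Fin k)) → IsSubword u w → length u ≡ n + c →
    (∀ v → Infix _≡_ v u → length v ≡ n → HasValence1 w v) →
    UltimatelyPeriodic w
lemma5p6 k w n n≥1 c L (_ , characterises-L) refl u (q , factor≡u) |u|≡n+c valence1-in-u =
  ultimatelyPeriodic-of-valence1-run w n q L n≥1 λ s s≤c → in-L s s≤c , valence1 s s≤c
  where
  valence1 : ∀ s → s ≤ c → HasValence1 w (factorAt w (q + s) n)
  valence1 s s≤c = valence1-in-u _ (subst (Infix _≡_ _) factor≡u factor-infix) (length-factorAt w (q + s) n)
    where
    factor-infix : Infix _≡_ (factorAt w (q + s) n) (factorAt w q (length u))
    factor-infix = factorAt-infix w q s n (length u)
      (subst (s + n ≤_) (trans (+-comm c n) (sym |u|≡n+c)) (+-monoˡ-≤ n s≤c))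
  in-L : ∀ s → s ≤ c → factorAt w (q + s) n ∈ L
  in-L s s≤c = proj₂ (characterises-L _) (factorAt-isSubword w _ _ , length-factorAt w _ _ , valence1 s s≤c)
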